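{- Let $F=(F_n)$ be a linear-like semiring family of graphs. Then for all finite graphs $G,H$, $\eta_{F,f}(G\ltimes H)=\eta_{F,f}(G)\,\eta_{F,f}(H)$ and $\eta_{F,f}(G\ast H)=\eta_{F,f}(G)\,\eta_{F,f}(H)$.
   Context: Graphs are undirected simple graphs, possibly infinite; $\omega$ is the clique number. The join $G+H$ is the disjoint union with all edges between the two parts added. The disjunctive product $G\ast H$ has vertex set $V(G)\times V(H)$ with $(v,w)\sim(v',w')$ iff $v\sim v'$ or $w\sim w'$. The lexicographic product $G\ltimes H$ has vertex set $V(G)\times V(H)$ with $(v,w)\sim(v',w')$ iff $v\sim v'$, or $v=v'$ and $w\sim w'$. For $d\in\mathbb{N}_+$, $X/d$ is the graph of $d$-cliques of $X$, with $S\sim T$ iff $S\cap T=\emptyset$ and $s\sim t$ for all $s\in S,t\in T$. A semiring family is a sequence $(F_n)_{n\in\mathbb{N}}$ with $F_0=\emptyset$, $F_1\ne\emptyset$, and homomorphisms $F_n+F_m\to F_{n+m}$, $F_n\ast F_m\to F_{nm}$. For $S\subseteq V(X)$, $S^\perp$ is the set of vertices adjacent to all vertices of $S$; $S$ is a flat if $S^{\perp\perp}=S$; $\mathrm{rk}(S)=\omega(S^{\perp\perp})$. $(F_n)$ is linear-like if for every $n$ and every flat $S\subseteq V(F_n)$, the induced subgraph on $S$ is homomorphically equivalent to $F_{\mathrm{rk}(S)}$. For finite $G$, $\eta_{F,f}(G)=\inf\{n/d: n\in\mathbb{N},d\in\mathbb{N}_+, G\to F_n/d\}$. -}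

module Defs where

open import Data.Nat using (ℕ; zero; suc; _+_; _*_; _≤_; _<_; NonZero)
open import Data.Fin using (Fin)
import Data.Fin as Fin
open import Data.Product using (Σ; ∃; ∃-syntax; _×_; _,_; proj₁; proj₂)
open import Data.Sum using (_⊎_; inj₁; inj₂)
open import Data.Unit using (⊤)
open import Data.Empty using (⊥)
open import Relation.Nullary using (¬_)
open import Relation.Binary.PropositionalEquality using (_≡_)
open import Function.Bundles using (_↔_; _⇔_)

record Graph : Set₁ where
  field
    V      : Set
    _~_    : V → V → Set
    sym~   : ∀ {u v} → u ~ v → v ~ u
    irrefl : ∀ {v} → ¬ (v ~ v)
open Graph public

Finite : Graph → Set
Finite G = Σ ℕ λ k → V G ↔ Fin k

Hom : Graph → Graph → Set
Hom G X = Σ (V G → V X) λ f → ∀ {u v} → _~_ G u v → _~_ X (f u) (f v)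

HomEquiv : Graph → Graph → Set
HomEquiv G X = Hom G X × Hom X G

JoinAdj : (G H : Graph) → V G ⊎ V H → V G ⊎ V H → Set
JoinAdj G H (inj₁ a) (inj₁ b) = _~_ G a b
JoinAdj G H (inj₂ a) (inj₂ b) = _~_ H a b
JoinAdj G H (inj₁ _) (inj₂ _) = ⊤
JoinAdj G H (inj₂ _) (inj₁ _) = ⊤

join : Graph → Graph → Graph
join G H = record
  { V = V G ⊎ V H
  ; _~_ = JoinAdj G H
  ; sym~ = λ { {inj₁ a} {inj₁ b} e → sym~ G e
             ; {inj₂ a} {inj₂ b} e → sym~ H e
             ; {inj₁ a} {inj₂ b} e → e
             ; {inj₂ a} {inj₁ b} e → e }
  ; irrefl = λ { {inj₁ a} e → irrefl G e ; {inj₂ a} e → irrefl H e }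
  }

disj : Graph → Graph → Graph
disj G H = record
  { V = V G × V H
  ; _~_ = λ p q → _~_ G (proj₁ p) (proj₁ q) ⊎ _~_ H (proj₂ p) (proj₂ q)
  ; sym~ = λ { (inj₁ e) → inj₁ (sym~ G e) ; (inj₂ e) → inj₂ (sym~ H e) }
  ; irrefl = λ { (inj₁ e) → irrefl G e ; (inj₂ e) → irrefl H e }
  }

lex : Graph → Graph → Graph
lex G H = record
  { V = V G × V H
  ; _~_ = λ p q → _~_ G (proj₁ p) (proj₁ q)
                  ⊎ (proj₁ p ≡ proj₁ q × _~_ H (proj₂ p) (proj₂ q))
  ; sym~ = λ { (inj₁ e) → inj₁ (sym~ G e)
             ; (inj₂ (Relation.Binary.PropositionalEquality.refl , e)) → inj₂ (Relation.Binary.PropositionalEquality.refl , sym~ H e) }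
  ; irrefl = λ { (inj₁ e) → irrefl G e ; (inj₂ (_ , e)) → irrefl H e }
  }

Clique : Graph → ℕ → Set
Clique X d = Σ (Fin d → V X) λ s → ∀ i j → ¬ (i ≡ j) → _~_ X (s i) (s j)

-- X / d (d ≥ 1): graph of d-cliques, S ~ T iff every vertex of S is adjacent
-- to every vertex of T (this forces S ∩ T = ∅ since X is loopless).
_⊘_ : Graph → (d : ℕ) → .{{NonZero d}} → Graph
_⊘_ X (suc k) = record
  { V = Clique X (suc k)
  ; _~_ = λ S T → ∀ i j → _~_ X (proj₁ S i) (proj₁ T j)
  ; sym~ = λ e i j → sym~ X (e j i)
  ; irrefl = λ e → irrefl X (e Fin.zero Fin.zero)
  }

record SemiringFamily (F : ℕ → Graph) : Set where
  field
    empty0 : ¬ V (F 0)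
    point1 : V (F 1)
    addHom : ∀ n m → Hom (join (F n) (F m)) (F (n + m))
    mulHom : ∀ n m → Hom (disj (F n) (F m)) (F (n * m))

Subset : Graph → Set₁
Subset X = V X → Set

perp : (X : Graph) → Subset X → Subset X
perp X S v = ∀ s → S s → _~_ X v s

IsFlat : (X : Graph) → Subset X → Set
IsFlat X S = ∀ v → S v ⇔ perp X (perp X S) v

induced : (X : Graph) → Subset X → Graph
induced X S = record
  { V = Σ (V X) S
  ; _~_ = λ a b → _~_ X (proj₁ a) (proj₁ b)
  ; sym~ = sym~ X
  ; irrefl = irrefl X
  }

CliqueNumberIs : Graph → ℕ → Set
CliqueNumberIs Y r = Clique Y r × ¬ Clique Y (suc r)

-- Linear-like: every flat S of F n has rk(S) = ω(S^⊥⊥) a natural number r, and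
-- the induced subgraph on S is homomorphically equivalent to F r.
LinearLike : (ℕ → Graph) → Set₁
LinearLike F = ∀ n (S : Subset (F n)) → IsFlat (F n) S →
  Σ ℕ λ r → CliqueNumberIs (induced (F n) (perp (F n) (perp (F n) S))) r
          × HomEquiv (induced (F n) S) (F r)

-- η_{F,f}(X) < p / r  (r ≥ 1), i.e. some n/d with X → F n / d satisfies n/d < p/r.
EtaBelow : (ℕ → Graph) → Graph → ℕ → ℕ → Set
EtaBelow F X p r =
  ∃[ n ] ∃[ d ] Σ (NonZero d) λ nz → Hom X (_⊘_ (F n) d {{nz}}) × n * r < p * d

-- η_{F,f}(G) · η_{F,f}(H) < p / r  (r ≥ 1): the product of the two infima is the
-- infimum of the products (n₁/d₁)(n₂/d₂) of achievable ratios.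
EtaProdBelow : (ℕ → Graph) → Graph → Graph → ℕ → ℕ → Set
EtaProdBelow F G H p r =
  ∃[ n₁ ] ∃[ d₁ ] ∃[ n₂ ] ∃[ d₂ ] Σ (NonZero d₁) λ nz₁ → Σ (NonZero d₂) λ nz₂ →
    Hom G (_⊘_ (F n₁) d₁ {{nz₁}}) × Hom H (_⊘_ (F n₂) d₂ {{nz₂}})
    × (n₁ * n₂) * r < p * (d₁ * d₂)

{-# OPTIONS --safe #-}
-- The disjunctive product has more edges than the lexicographic one, and the
-- multiplication maps F n₁ ∗ F n₂ → F (n₁ n₂) send a product of a d₁-clique and a
-- d₂-clique to a d₁d₂-clique, so G → F n₁ / d₁ and H → F n₂ / d₂ give
-- G ∗ H → F (n₁ n₂) / (d₁ d₂).  Conversely, let φ : G ⋉ H → F n / d.  For each g the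
-- cliques φ(g, h) span a flat S g = (⋃ₕ φ(g, h))^⊥⊥, and linear-likeness gives
-- S g ≃ F (r g) with r g = rk (S g), hence H → F (r g) / d.  Adjacent g, g′ have fully
-- adjacent flats, so choosing an r-clique in each S g^⊥⊥, r = min_g r g, gives G → F n / r,
-- and (n / r) (r / d) = n / d.
module Submission where

open import Defs
open import Data.Nat using (ℕ; NonZero; zero; suc; _*_; _≤_; _<_; z≤n; s≤s)
open import Data.Nat.Properties using (*-monoˡ-<; *-identityʳ; *-zeroʳ; *-commutativeSemigroup)
open import Algebra.Properties.CommutativeSemigroup *-commutativeSemigroup using (xy∙z≈xz∙y; x∙yz≈xz∙y)
import Data.Fin as Fin
open import Data.Fin using (Fin; inject≤; remQuot) renaming (zero to fzero; suc to fsuc)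
open import Data.Fin.Properties using (inject≤-injective; *↔×)
open import Data.List using (List; allFin) renaming (map to mapList)
open import Data.List.Extrema.Nat using (argmin; f[argmin]≤f[xs])
open import Data.List.Membership.Propositional.Properties using (∈-map⁺; ∈-allFin)
import Data.List.Relation.Unary.All as All
open import Data.Product using (Σ; ∃-syntax; _×_; _,_; proj₁; proj₂)
import Data.Product as Product
open import Data.Sum using (inj₁; inj₂)
open import Data.Unit using (tt)
open import Data.Empty using (⊥-elim)
open import Relation.Nullary using (¬_; yes; no)
open import Relation.Binary.Definitions using (DecidableEquality)
open import Relation.Binary.PropositionalEquality using (_≡_; refl; sym; cong; subst; subst₂)
open import Function using (_∘_; Injective)
open import Function.Bundles using (_⇔_; mk⇔; Inverse; Injection)
open import Function.Properties.Inverse using (↔⇒↣)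

-- Graph arguments are often explicit: Hom X Y unfolds to a Σ-type from which X and Y
-- cannot be inferred.

IsClique : (X : Graph) {I : Set} → (I → V X) → Set
IsClique X s = ∀ i j → ¬ i ≡ j → _~_ X (s i) (s j)

IsClique-∘ : ∀ X {I J} {s : I → V X} {ι : J → I} →
             IsClique X s → Injective _≡_ _≡_ ι → IsClique X (s ∘ ι)
IsClique-∘ X s-clique ι-inj i j i≢j = s-clique _ _ (i≢j ∘ ι-inj)

IsClique-disj : ∀ X Y {I J} {s : I → V X} {t : J → V Y} → DecidableEquality I →
                IsClique X s → IsClique Y t → IsClique (disj X Y) (Product.map s t)
IsClique-disj X Y _≟_ s-clique t-clique (i , j) (i′ , j′) ij≢i′j′ with i ≟ i′
... | no i≢i′  = inj₁ (s-clique i i′ i≢i′)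
... | yes refl = inj₂ (t-clique j j′ (ij≢i′j′ ∘ cong (i ,_)))

Clique-shrink : ∀ X {m k} → m ≤ k → Clique X k → Clique X m
Clique-shrink X m≤k (s , s-clique) =
  s ∘ (λ i → inject≤ i m≤k) , IsClique-∘ X s-clique (inject≤-injective m≤k m≤k _ _)

Clique-disj : ∀ X Y {a b} → Clique X a → Clique Y b → Clique (disj X Y) (a * b)
Clique-disj X Y {a} {b} (s , s-clique) (t , t-clique) =
  Product.map s t ∘ remQuot b ,
  IsClique-∘ (disj X Y) (IsClique-disj X Y Fin._≟_ s-clique t-clique)
                        (Injection.injective (↔⇒↣ (*↔× {a} {b})))

singleton : ∀ X → V X → Clique X 1
singleton X x = (λ _ → x) , λ { fzero fzero 0≢0 → ⊥-elim (0≢0 refl) }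

cliqueNumber-positive : ∀ Y {r} → CliqueNumberIs Y r → V Y → 1 ≤ r
cliqueNumber-positive Y {zero} (_ , no-1-clique) y = ⊥-elim (no-1-clique (singleton Y y))
cliqueNumber-positive Y {suc _} _                _ = s≤s z≤n

Hom-clique : ∀ X Y {d} → Hom X Y → Clique X d → Clique Y d
Hom-clique X Y (f , f-hom) (s , s-clique) = f ∘ s , λ i j i≢j → f-hom (s-clique i j i≢j)

Hom-into-clique : ∀ X Y {k} → Clique Y k → (ι : V X → Fin k) → Injective _≡_ _≡_ ι → Hom X Y
Hom-into-clique X Y (s , s-clique) ι ι-inj =
  s ∘ ι , λ {u} {v} u~v → s-clique (ι u) (ι v) (λ ιu≡ιv → irrefl X (subst (_~_ X u) (sym (ι-inj ιu≡ιv)) u~v))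

Hom-singletons : ∀ X Y → Hom X Y → Hom X (Y ⊘ 1)
Hom-singletons X Y (f , f-hom) = singleton Y ∘ f , λ u~v _ _ → f-hom u~v

Hom-disj-⊘ : ∀ G H X Y Z a b → Hom (disj X Y) Z →
             Hom G (X ⊘ suc a) → Hom H (Y ⊘ suc b) → Hom (disj G H) (Z ⊘ (suc a * suc b))
Hom-disj-⊘ G H X Y Z a b μ (f , f-hom) (g , g-hom) =
  (λ (x , y) → Hom-clique (disj X Y) Z μ (Clique-disj X Y (f x) (g y))) ,
  λ { (inj₁ x~x′) _ _ → proj₂ μ (inj₁ (f-hom x~x′ _ _))
    ; (inj₂ y~y′) _ _ → proj₂ μ (inj₂ (g-hom y~y′ _ _)) }

lex⊆disj : ∀ G H {p q} → _~_ (lex G H) p q → _~_ (disj G H) p q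
lex⊆disj G H (inj₁ e)       = inj₁ e
lex⊆disj G H (inj₂ (_ , e)) = inj₂ e

induced-inclusion : ∀ X (S : Subset X) → Hom (induced X S) X
induced-inclusion X S = proj₁ , λ e → e

FullyAdjacent : (X : Graph) → Subset X → Subset X → Set
FullyAdjacent X A B = ∀ {s t} → A s → B t → _~_ X s t

⊆-perp² : ∀ X (A : Subset X) {v} → A v → perp X (perp X A) v
⊆-perp² X A a s s∈A⊥ = sym~ X (s∈A⊥ _ a)

perp²-isFlat : ∀ X (A : Subset X) → IsFlat X (perp X (perp X A))
perp²-isFlat X A v =
  mk⇔ (⊆-perp² X (perp X (perp X A))) (λ v∈A⁗ s s∈A⊥ → v∈A⁗ s (⊆-perp² X (perp X A) s∈A⊥))

perp²-fullyAdjacent : ∀ X {A B : Subset X} → FullyAdjacent X A B →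
                      FullyAdjacent X (perp X (perp X A)) (perp X (perp X B))
perp²-fullyAdjacent X A⇸B x∈A″ y∈B″ = x∈A″ _ (λ _ a∈A → y∈B″ _ (λ _ b∈B → A⇸B a∈A b∈B))

finite-argmin : ∀ X → Finite X → V X → (f : V X → ℕ) → Σ (V X) λ x₀ → ∀ x → f x₀ ≤ f x
finite-argmin X (k , X↔Fin) x f =
  argmin f x vertices ,
  λ y → subst (λ z → f (argmin f x vertices) ≤ f z) (inverseʳ refl)
          (All.lookup (f[argmin]≤f[xs] {f = f} x vertices) (∈-map⁺ from (∈-allFin (to y))))
  where
  open Inverse X↔Fin
  vertices : List (V X)
  vertices = mapList from (allFin k)

ratio-telescope : ∀ n r p d m → .{{NonZero m}} → n * r < p * d → (n * m) * r < p * (m * d)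
ratio-telescope n r p d m nr<pd =
  subst₂ _<_ (sym (xy∙z≈xz∙y n m r)) (sym (x∙yz≈xz∙y p m d)) (*-monoˡ-< m nr<pd)

positive-numerator : ∀ {n p d} → n < p * d → 0 < p
positive-numerator {p = suc _} _ = s≤s z≤n

module _ {F : ℕ → Graph} (SF : SemiringFamily F) where
  open SemiringFamily SF

  complete-clique : ∀ k → Clique (F k) k
  complete-clique zero    = (λ ()) , λ ()
  complete-clique (suc k) = s , s-clique
    where
    join⇒F : Hom (join (F 1) (F k)) (F (suc k))
    join⇒F = addHom 1 k
    s : Fin (suc k) → V (F (suc k))
    s fzero    = proj₁ join⇒F (inj₁ point1)
    s (fsuc i) = proj₁ join⇒F (inj₂ (proj₁ (complete-clique k) i))
    s-clique : IsClique (F (suc k)) s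
    s-clique fzero    fzero    0≢0 = ⊥-elim (0≢0 refl)
    s-clique fzero    (fsuc j) _   = proj₂ join⇒F {inj₁ _} {inj₂ _} tt
    s-clique (fsuc i) fzero    _   = proj₂ join⇒F {inj₂ _} {inj₁ _} tt
    s-clique (fsuc i) (fsuc j) i≢j = proj₂ join⇒F (proj₂ (complete-clique k) i j (i≢j ∘ cong fsuc))

  Finite⇒F⊘1 : ∀ X → (fin : Finite X) → Hom X (F (proj₁ fin) ⊘ 1)
  Finite⇒F⊘1 X (k , X↔Fin) =
    Hom-singletons X (F k)
      (Hom-into-clique X (F k) (complete-clique k) (Inverse.to X↔Fin) (Injection.injective (↔⇒↣ X↔Fin)))

  etaProdBelow-sizes : ∀ G H p r (finG : Finite G) (finH : Finite H) →
                       (proj₁ finG * proj₁ finH) * r < p → EtaProdBelow F G H p r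
  etaProdBelow-sizes G H p r finG finH lt =
    _ , 1 , _ , 1 , _ , _ , Finite⇒F⊘1 G finG , Finite⇒F⊘1 H finH , subst (_ <_) (sym (*-identityʳ p)) lt

  etaProdBelow⇒etaBelow-disj : ∀ G H p r → EtaProdBelow F G H p r → EtaBelow F (disj G H) p r
  etaProdBelow⇒etaBelow-disj G H p r (n₁ , suc a , n₂ , suc b , _ , _ , G⇒ , H⇒ , lt) =
    n₁ * n₂ , suc a * suc b , _ , Hom-disj-⊘ G H (F n₁) (F n₂) (F (n₁ * n₂)) a b (mulHom n₁ n₂) G⇒ H⇒ , lt

etaBelow-disj⇒lex : ∀ F G H p r → EtaBelow F (disj G H) p r → EtaBelow F (lex G H) p r
etaBelow-disj⇒lex F G H p r (n , d , d≢0 , (f , f-hom) , lt) = n , d , d≢0 , (f , f-hom ∘ lex⊆disj G H) , lt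

module _ {F : ℕ → Graph} (LL : LinearLike F) (G H : Graph) (n d : ℕ)
         (φ : Hom (lex G H) (F n ⊘ suc d)) where

  column : V G → V H → Clique (F n) (suc d)
  column g h = proj₁ φ (g , h)

  fibre : V G → Subset (F n)
  fibre g v = ∃[ h ] ∃[ i ] proj₁ (column g h) i ≡ v

  span : V G → Subset (F n)
  span g = perp (F n) (perp (F n) (fibre g))

  span⊥⊥ : V G → Subset (F n)
  span⊥⊥ g = perp (F n) (perp (F n) (span g))

  rank-data : ∀ g → Σ ℕ λ r → CliqueNumberIs (induced (F n) (span⊥⊥ g)) r
                                × HomEquiv (induced (F n) (span g)) (F r)
  rank-data g = LL n (span g) (perp²-isFlat (F n) (fibre g))

  rank : V G → ℕ
  rank g = proj₁ (rank-data g)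

  rank-positive : V H → ∀ g → 1 ≤ rank g
  rank-positive h g =
    cliqueNumber-positive (induced (F n) (span⊥⊥ g)) (proj₁ (proj₂ (rank-data g)))
      (proj₁ (column g h) fzero , ⊆-perp² (F n) (span g) (⊆-perp² (F n) (fibre g) (h , fzero , refl)))

  H⇒F[rank]⊘ : ∀ g → Hom H (F (rank g) ⊘ suc d)
  H⇒F[rank]⊘ g =
    (λ h → Hom-clique (induced (F n) (span g)) (F (rank g)) span⇒F (column-in-span h)) ,
    λ h~h′ i j → proj₂ span⇒F (proj₂ φ (inj₂ (refl , h~h′)) i j)
    where
    span⇒F : Hom (induced (F n) (span g)) (F (rank g))
    span⇒F = proj₁ (proj₂ (proj₂ (rank-data g)))
    column-in-span : V H → Clique (induced (F n) (span g)) (suc d)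
    column-in-span h = (λ i → proj₁ (column g h) i , ⊆-perp² (F n) (fibre g) (h , i , refl)) , proj₂ (column g h)

  fibres-fullyAdjacent : ∀ {g g′} → _~_ G g g′ → FullyAdjacent (F n) (fibre g) (fibre g′)
  fibres-fullyAdjacent g~g′ (h , i , refl) (h′ , j , refl) = proj₂ φ (inj₁ g~g′) i j

  G⇒F⊘ : ∀ c → (∀ g → suc c ≤ rank g) → Hom G (F n ⊘ suc c)
  G⇒F⊘ c c<rank =
    (λ g → Hom-clique (induced (F n) (span⊥⊥ g)) (F n) (induced-inclusion (F n) (span⊥⊥ g)) (clique g)) ,
    λ g~g′ i j → perp²-fullyAdjacent (F n) (perp²-fullyAdjacent (F n) (fibres-fullyAdjacent g~g′))
                   (proj₂ (proj₁ (clique _) i)) (proj₂ (proj₁ (clique _) j))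
    where
    clique : ∀ g → Clique (induced (F n) (span⊥⊥ g)) (suc c)
    clique g = Clique-shrink (induced (F n) (span⊥⊥ g)) (c<rank g) (proj₁ (proj₁ (proj₂ (rank-data g))))

  etaProdBelow-of-lex : Finite G → V G → V H → ∀ p r → n * r < p * suc d → EtaProdBelow F G H p r
  etaProdBelow-of-lex finG g h p r nr<pd with (g₀ , rank-minimal) ← finite-argmin G finG g rank
    with rank g₀ | rank-positive h g₀ | H⇒F[rank]⊘ g₀ | rank-minimal
  -- the case rank g₀ = 0 is refuted by rank-positive
  ... | suc c | _ | H⇒ | c<rank =
    n , suc c , suc c , suc d , _ , _ , G⇒F⊘ c c<rank , H⇒ , ratio-telescope n r p (suc d) (suc c) nr<pd

etaBelow-lex⇒etaProdBelow : ∀ {F} → SemiringFamily F → LinearLike F → ∀ G H → Finite G → Finite H →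
                            ∀ p r → EtaBelow F (lex G H) p r → EtaProdBelow F G H p r
etaBelow-lex⇒etaProdBelow SF LL G H finG@(zero , _) finH p r (_ , _ , _ , _ , lt) =
  etaProdBelow-sizes SF G H p r finG finH (positive-numerator lt)
etaBelow-lex⇒etaProdBelow SF LL G H finG@(k , _) finH@(zero , _) p r (_ , _ , _ , _ , lt) =
  etaProdBelow-sizes SF G H p r finG finH (subst (λ m → m * r < p) (sym (*-zeroʳ k)) (positive-numerator lt))
etaBelow-lex⇒etaProdBelow SF LL G H finG@(suc _ , G↔Fin) (suc _ , H↔Fin) p r (n , suc d , _ , φ , lt) =
  etaProdBelow-of-lex LL G H n d φ finG (Inverse.from G↔Fin fzero) (Inverse.from H↔Fin fzero) p r lt

proposition4p13 : (F : ℕ → Graph) → SemiringFamily F → LinearLike F →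
    (G H : Graph) → Finite G → Finite H →
    (p r : ℕ) → .{{NonZero r}} →
      (EtaBelow F (lex G H) p r ⇔ EtaProdBelow F G H p r)
      × (EtaBelow F (disj G H) p r ⇔ EtaProdBelow F G H p r)
proposition4p13 F SF LL G H finG finH p r =
  mk⇔ lex⇒prod (disj⇒lex ∘ prod⇒disj) ,
  mk⇔ (lex⇒prod ∘ disj⇒lex) prod⇒disj
  where
  lex⇒prod : EtaBelow F (lex G H) p r → EtaProdBelow F G H p r
  lex⇒prod = etaBelow-lex⇒etaProdBelow SF LL G H finG finH p r
  prod⇒disj : EtaProdBelow F G H p r → EtaBelow F (disj G H) p r
  prod⇒disj = etaProdBelow⇒etaBelow-disj SF G H p r
  disj⇒lex : EtaBelow F (disj G H) p r → EtaBelow F (lex G H) p r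
  disj⇒lex = etaBelow-disj⇒lex F G H p r
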